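{- If $H$ is a graph in which every edge lies in a triangle and $t\geq e(H)$ is an integer, then \[\operatorname{sat}_t(n,\mathfrak{R}(H))\geq \left(\frac{1}{4t}+o(1)\right)n\log n \quad (n\to\infty).\]
   Context: A $t$-edge-coloured graph is a graph $G$ with a function $c:E(G)\to\{1,\dots,t\}$ (not necessarily proper). A copy of $H$ is rainbow if all its edges receive distinct colours; $\mathfrak{R}(H)$ denotes the family of rainbow copies of $H$. A $t$-edge-coloured graph is $\mathfrak{R}(H)$-saturated if it contains no rainbow copy of $H$ but adding any non-edge in any colour from $\{1,\dots,t\}$ creates a rainbow copy of $H$. $\operatorname{sat}_t(n,\mathfrak{R}(H))$ is the minimum number of edges of such a graph on $n$ vertices. $e(H)$ is the number of edges of $H$. Logarithms are base 2. -}

module Defs where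

open import Data.Nat using (ℕ; _<ᵇ_)
open import Data.Fin using (Fin; toℕ; _≟_)
open import Data.Bool using (Bool; true; false; _∧_; _∨_; if_then_else_)
open import Data.List using (map; allFin)
open import Data.Nat.ListAction using (sum)
open import Data.Product using (Σ; ∃; _×_)
open import Data.Sum using (_⊎_)
open import Relation.Nullary using (¬_)
open import Relation.Nullary.Decidable using (⌊_⌋)
open import Relation.Binary.PropositionalEquality using (_≡_; _≢_)

record Graph (n : ℕ) : Set where
  field
    adj    : Fin n → Fin n → Bool
    sym    : ∀ i j → adj i j ≡ adj j i
    irrefl : ∀ i → adj i i ≡ false
open Graph public

edgeCount : {n : ℕ} → (Fin n → Fin n → Bool) → ℕ
edgeCount {n} a =
  sum (map (λ i → sum (map (λ j → if a i j ∧ (toℕ i <ᵇ toℕ j) then 1 else 0)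
                            (allFin n)))
           (allFin n))

e : {n : ℕ} → Graph n → ℕ
e G = edgeCount (adj G)

-- A t-edge-colouring (not necessarily proper), colours Fin t ≅ {1,…,t};
-- given on all pairs, symmetric; only values on edges are relevant.
record Colouring (n t : ℕ) : Set where
  field
    col    : Fin n → Fin n → Fin t
    colSym : ∀ i j → col i j ≡ col j i
open Colouring public

EveryEdgeInTriangle : {h : ℕ} → Graph h → Set
EveryEdgeInTriangle {h} H =
  ∀ u v → adj H u v ≡ true → ∃ λ w → adj H u w ≡ true × adj H v w ≡ true

RainbowCopy : {h n t : ℕ} → Graph h → (Fin n → Fin n → Bool) → (Fin n → Fin n → Fin t) → Set
RainbowCopy {h} {n} H a c =
  Σ (Fin h → Fin n) λ φ →
    (∀ u v → φ u ≡ φ v → u ≡ v) ×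
    (∀ u v → adj H u v ≡ true → a (φ u) (φ v) ≡ true) ×
    (∀ u v u′ v′ → adj H u v ≡ true → adj H u′ v′ ≡ true →
       c (φ u) (φ v) ≡ c (φ u′) (φ v′) →
       (u ≡ u′ × v ≡ v′) ⊎ (u ≡ v′ × v ≡ u′))

isPair : {n : ℕ} → Fin n → Fin n → Fin n → Fin n → Bool
isPair x y a b = (⌊ a ≟ x ⌋ ∧ ⌊ b ≟ y ⌋) ∨ (⌊ a ≟ y ⌋ ∧ ⌊ b ≟ x ⌋)

addAdj : {n : ℕ} → (Fin n → Fin n → Bool) → Fin n → Fin n → (Fin n → Fin n → Bool)
addAdj a x y i j = a i j ∨ isPair x y i j

addCol : {n t : ℕ} → (Fin n → Fin n → Fin t) → Fin n → Fin n → Fin t → (Fin n → Fin n → Fin t)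
addCol c x y α i j = if isPair x y i j then α else c i j

record Saturated {h n t : ℕ} (H : Graph h) (G : Graph n) (c : Colouring n t) : Set where
  field
    noRainbow : ¬ RainbowCopy H (adj G) (col c)
    saturate  : ∀ x y → x ≢ y → adj G x y ≡ false → (α : Fin t) →
                RainbowCopy H (addAdj (adj G) x y) (addCol (col c) x y α)

-- Saturation lemma: adding a non-edge xy in any colour creates a rainbow
-- copy of H that must use xy, and a triangle through that edge of H gives a
-- common neighbour w of x, y with c(xw) ≠ c(yw).  Encode each vertex x by a box
-- in the grid (Fin (t+1))ⁿ: side {0} at x, side {1 + c(xw)} at each neighbour w,
-- everything elsewhere.  The saturation lemma makes the boxes pairwise separated
-- (disjoint in some coordinate), so Kraft's inequality Σ vol ≤ (t+1)ⁿ bounds the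
-- number of vertices of degree ≤ D by (t+1)^(D+1).  Averaging gives
-- n(D+1) ≤ 2e(G) + (t+1)^(D+1)(D+1) for every D, and a suitable D yields the bound.

module Submission where

open import Defs hiding (sym)
open import Data.Nat.Properties hiding (_≟_; suc-injective)
open import Algebra.Properties.Semiring.Sum +-*-semiring
  using (sum; sum-syntax; sum-cong-≗; sum-replicate-zero; ∑-distrib-+; ∑-comm; *-distribˡ-sum; *-distribʳ-sum)
open import Algebra.Properties.CommutativeSemigroup *-commutativeSemigroup
  using () renaming (interchange to *-interchange)
open import Algebra.Properties.CommutativeSemigroup +-commutativeSemigroup
  using () renaming (interchange to +-interchange)
open import Data.Bool using (Bool; true; false; _∧_; _∨_; if_then_else_)
open import Data.Bool.Properties using (∨-identityʳ; ∧-zeroʳ; T-≡) renaming (_≟_ to _≟ᵇ_)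
open import Data.Empty using (⊥; ⊥-elim)
open import Data.Fin using (Fin; zero; suc; toℕ; _≟_; fromℕ<)
open import Data.Fin.Properties using (¬Fin0; suc-injective; any?; toℕ-injective)
open import Data.List using (map; tabulate)
open import Data.Nat using (ℕ; zero; suc; _+_; _*_; _∸_; _^_; _≤_; _<_; _<ᵇ_; z≤n; s≤s; NonZero; >-nonZero)
import Data.Nat.ListAction as List
open import Data.Nat.Tactic.RingSolver using (solve-∀)
open import Data.Product using (∃; _×_; _,_; proj₁; proj₂)
open import Data.Sum using (_⊎_; inj₁; inj₂)
open import Function using (_∘_)
open import Function.Bundles using (Equivalence)
open import Relation.Binary.Definitions using (tri<; tri≈; tri>)
open import Relation.Binary.PropositionalEquality
  using (_≡_; _≢_; refl; sym; trans; cong; cong₂; subst)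
open import Relation.Nullary using (¬_; Dec; yes; no)
open import Relation.Nullary.Decidable using (⌊_⌋)

𝟙 : Bool → ℕ
𝟙 true = 1
𝟙 false = 0

𝟙-∧ : ∀ a b c → 𝟙 a * (𝟙 b * c) ≡ 𝟙 (a ∧ b) * c
𝟙-∧ true b c = +-identityʳ (𝟙 b * c)
𝟙-∧ false b c = refl

∧-true : ∀ {a b} → a ∧ b ≡ true → a ≡ true × b ≡ true
∧-true {true} {true} refl = refl , refl

∑-mono-≤ : ∀ {n} {f g : Fin n → ℕ} → (∀ i → f i ≤ g i) → sum f ≤ sum g
∑-mono-≤ {zero} _ = z≤n
∑-mono-≤ {suc n} f≤g = +-mono-≤ (f≤g zero) (∑-mono-≤ (f≤g ∘ suc))

∑-const : ∀ n c → ∑[ i < n ] c ≡ n * c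
∑-const zero c = refl
∑-const (suc n) c = cong (c +_) (∑-const n c)

∑-point : ∀ {n} (x : Fin n) → ∑[ w < n ] 𝟙 ⌊ w ≟ x ⌋ ≡ 1
∑-point {suc n} zero = cong suc (sum-replicate-zero n)
∑-point {suc n} (suc x) = trans (sum-cong-≗ (λ w → cong 𝟙 (suc-≟-suc w x))) (∑-point x)
  where
  suc-≟-suc : ∀ {n} (w x : Fin n) → ⌊ suc w ≟ suc x ⌋ ≡ ⌊ w ≟ x ⌋
  suc-≟-suc w x with w ≟ x
  ... | yes _ = refl
  ... | no _ = refl

atMostOne : ∀ {m} (sel : Fin m → Bool) →
  (∀ x y → x ≢ y → sel x ≡ true → sel y ≡ true → ⊥) → ∑[ x < m ] 𝟙 (sel x) ≤ 1
atMostOne {zero} sel excl = z≤n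
atMostOne {suc m} sel excl with sel zero in sel₀
... | false = atMostOne (sel ∘ suc) (λ x y x≢y → excl (suc x) (suc y) (x≢y ∘ suc-injective))
... | true = s≤s (≤-reflexive (trans (sum-cong-≗ unselected) (sum-replicate-zero m)))
  where
  unselected : ∀ x → 𝟙 (sel (suc x)) ≡ 0
  unselected x with sel (suc x) in selₓ
  ... | false = refl
  ... | true = ⊥-elim (excl zero (suc x) (λ ()) sel₀ selₓ)

-- Boxes in the grid (Fin s)ⁿ: products A₀ × ⋯ × Aₙ₋₁ of subsets of Fin s.
module Boxes (s : ℕ) where

  Box : ℕ → Set
  Box n = Fin n → Fin s → Bool

  size : (Fin s → Bool) → ℕ
  size A = ∑[ v < s ] 𝟙 (A v)

  vol : ∀ {n} → Box n → ℕ
  vol {zero} B = 1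
  vol {suc n} B = size (B zero) * vol (B ∘ suc)

  Separated : ∀ {n} → Box n → Box n → Set
  Separated B C = ∃ λ w → ∀ v → B w v ≡ true → C w v ≡ true → ⊥

  PairwiseSeparated : ∀ {m n} → (Fin m → Bool) → (Fin m → Box n) → Set
  PairwiseSeparated sel B = ∀ x y → x ≢ y → sel x ≡ true → sel y ≡ true → Separated (B x) (B y)

  -- Induction on n: slicing at the first coordinate by a value v leaves a
  -- pairwise separated subfamily of (n-1)-dimensional boxes, which is why the
  -- statement is made for an arbitrary selected subfamily.
  kraft : ∀ n {m} (sel : Fin m → Bool) (B : Fin m → Box n) → PairwiseSeparated sel B →
          ∑[ x < m ] (𝟙 (sel x) * vol (B x)) ≤ s ^ n
  kraft zero {m} sel B sep = begin
    ∑[ x < m ] (𝟙 (sel x) * 1) ≡⟨ sum-cong-≗ (λ x → *-identityʳ (𝟙 (sel x))) ⟩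
    ∑[ x < m ] 𝟙 (sel x)       ≤⟨ atMostOne sel (λ x y x≢y sx sy → ¬Fin0 (proj₁ (sep x y x≢y sx sy))) ⟩
    1                          ∎
    where open ≤-Reasoning
  kraft (suc n) {m} sel B sep = begin
    ∑[ x < m ] (𝟙 (sel x) * (size (B x zero) * vol (tail x)))
      ≡⟨ sum-cong-≗ (λ x → cong (𝟙 (sel x) *_) (*-distribʳ-sum (vol (tail x)) (λ v → 𝟙 (B x zero v)))) ⟩
    ∑[ x < m ] (𝟙 (sel x) * ∑[ v < s ] (𝟙 (B x zero v) * vol (tail x)))
      ≡⟨ sum-cong-≗ (λ x → *-distribˡ-sum (𝟙 (sel x)) (λ v → 𝟙 (B x zero v) * vol (tail x))) ⟩
    ∑[ x < m ] ∑[ v < s ] (𝟙 (sel x) * (𝟙 (B x zero v) * vol (tail x)))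
      ≡⟨ sum-cong-≗ (λ x → sum-cong-≗ (λ v → 𝟙-∧ (sel x) (B x zero v) (vol (tail x)))) ⟩
    ∑[ x < m ] ∑[ v < s ] (𝟙 (slice v x) * vol (tail x))
      ≡⟨ ∑-comm (λ x v → 𝟙 (slice v x) * vol (tail x)) ⟩
    ∑[ v < s ] ∑[ x < m ] (𝟙 (slice v x) * vol (tail x))
      ≤⟨ ∑-mono-≤ (λ v → kraft n (slice v) tail (slice-separated v)) ⟩
    ∑[ v < s ] (s ^ n)
      ≡⟨ ∑-const s (s ^ n) ⟩
    s * s ^ n ∎
    where
    open ≤-Reasoning
    tail : Fin m → Box n
    tail x = B x ∘ suc
    slice : Fin s → Fin m → Bool
    slice v x = sel x ∧ B x zero v
    -- two such boxes share v in coordinate 0, so they are separated later on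
    slice-separated : ∀ v → PairwiseSeparated (slice v) tail
    slice-separated v x y x≢y inX inY
      with sep x y x≢y (proj₁ (∧-true inX)) (proj₁ (∧-true inY))
    ... | zero , disjoint = ⊥-elim (disjoint v (proj₂ (∧-true inX)) (proj₂ (∧-true inY)))
    ... | suc w , disjoint = w , disjoint

  vol-lowerBound : ∀ {n} (B : Box n) (k : Fin n → ℕ) →
    (∀ w → s ≤ size (B w) * s ^ k w) → s ^ n ≤ vol B * s ^ sum k
  vol-lowerBound {zero} B k big = ≤-refl
  vol-lowerBound {suc n} B k big = begin
    s * s ^ n
      ≤⟨ *-mono-≤ (big zero) (vol-lowerBound (B ∘ suc) (k ∘ suc) (big ∘ suc)) ⟩
    (size (B zero) * s ^ k zero) * (vol (B ∘ suc) * s ^ sum (k ∘ suc))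
      ≡⟨ *-interchange (size (B zero)) (s ^ k zero) (vol (B ∘ suc)) (s ^ sum (k ∘ suc)) ⟩
    vol B * (s ^ k zero * s ^ sum (k ∘ suc))
      ≡⟨ cong (vol B *_) (sym (^-distribˡ-+-* s (k zero) (sum (k ∘ suc)))) ⟩
    vol B * s ^ sum k ∎
    where open ≤-Reasoning

  fewLightIndices : ∀ {n m} .{{_ : NonZero s}} (B : Fin m → Box n) (d : Fin m → ℕ) →
    (∀ x y → x ≢ y → Separated (B x) (B y)) →
    (∀ x → s ^ n ≤ vol (B x) * s ^ suc (d x)) →
    ∀ D → ∑[ x < m ] 𝟙 ⌊ d x ≤? D ⌋ ≤ s ^ suc D
  fewLightIndices {n} {m} B d sep large D =
    *-cancelʳ-≤ (∑[ x < m ] light x) (s ^ suc D) (s ^ n) {{m^n≢0 s n}} (begin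
      (∑[ x < m ] light x) * s ^ n
        ≡⟨ *-distribʳ-sum (s ^ n) light ⟩
      ∑[ x < m ] (light x * s ^ n)
        ≤⟨ ∑-mono-≤ light-vol ⟩
      ∑[ x < m ] (s ^ suc D * (light x * vol (B x)))
        ≡⟨ sym (*-distribˡ-sum (s ^ suc D) (λ x → light x * vol (B x))) ⟩
      s ^ suc D * ∑[ x < m ] (light x * vol (B x))
        ≤⟨ *-monoʳ-≤ (s ^ suc D) (kraft n (λ x → ⌊ d x ≤? D ⌋) B (λ x y x≢y _ _ → sep x y x≢y)) ⟩
      s ^ suc D * s ^ n ∎)
    where
    open ≤-Reasoning
    light : Fin m → ℕ
    light x = 𝟙 ⌊ d x ≤? D ⌋
    light-vol : ∀ x → light x * s ^ n ≤ s ^ suc D * (light x * vol (B x))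
    light-vol x with d x ≤? D
    ... | no _ = z≤n
    ... | yes dx≤D = begin
      1 * s ^ n                   ≡⟨ *-identityˡ (s ^ n) ⟩
      s ^ n                       ≤⟨ large x ⟩
      vol (B x) * s ^ suc (d x)   ≤⟨ *-monoʳ-≤ (vol (B x)) (^-monoʳ-≤ s (s≤s dx≤D)) ⟩
      vol (B x) * s ^ suc D       ≡⟨ *-comm (vol (B x)) (s ^ suc D) ⟩
      s ^ suc D * vol (B x)       ≡⟨ cong (s ^ suc D *_) (sym (*-identityˡ (vol (B x)))) ⟩
      s ^ suc D * (1 * vol (B x)) ∎

  -- Consequently the weights are large on average: m (D+1) ≤ Σ d + s^(D+1) (D+1),
  -- since every index has weight ≥ D+1 unless it is one of the few light ones.
  weightBound : ∀ {n m} .{{_ : NonZero s}} (B : Fin m → Box n) (d : Fin m → ℕ) →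
    (∀ x y → x ≢ y → Separated (B x) (B y)) →
    (∀ x → s ^ n ≤ vol (B x) * s ^ suc (d x)) →
    ∀ D → m * suc D ≤ sum d + s ^ suc D * suc D
  weightBound {n} {m} B d sep large D = begin
    m * suc D
      ≡⟨ sym (∑-const m (suc D)) ⟩
    ∑[ x < m ] suc D
      ≤⟨ ∑-mono-≤ heavy-or-light ⟩
    ∑[ x < m ] (d x + light x * suc D)
      ≡⟨ ∑-distrib-+ d (λ x → light x * suc D) ⟩
    sum d + ∑[ x < m ] (light x * suc D)
      ≡⟨ cong (sum d +_) (sym (*-distribʳ-sum (suc D) light)) ⟩
    sum d + (∑[ x < m ] light x) * suc D
      ≤⟨ +-monoʳ-≤ (sum d) (*-monoˡ-≤ (suc D) (fewLightIndices B d sep large D)) ⟩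
    sum d + s ^ suc D * suc D ∎
    where
    open ≤-Reasoning
    light : Fin m → ℕ
    light x = 𝟙 ⌊ d x ≤? D ⌋
    heavy-or-light : ∀ x → suc D ≤ d x + light x * suc D
    heavy-or-light x with d x ≤? D
    ... | yes _ = ≤-trans (≤-reflexive (sym (+-identityʳ (suc D)))) (m≤n+m (suc D + 0) (d x))
    ... | no dx≰D = ≤-trans (≰⇒> dx≰D) (m≤m+n (d x) 0)

^-distribʳ-* : ∀ a b k → (a * b) ^ k ≡ a ^ k * b ^ k
^-distribʳ-* a b zero = refl
^-distribʳ-* a b (suc k) = trans (cong (a * b *_) (^-distribʳ-* a b k)) (*-interchange a b (a ^ k) (b ^ k))

m<s^m : ∀ {s} → 2 ≤ s → ∀ m → m < s ^ m
m<s^m s≥2 zero = s≤s z≤n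
m<s^m {s} s≥2 (suc m) = begin-strict
  suc m         ≤⟨ m<s^m s≥2 m ⟩
  s ^ m         <⟨ m<m+n (s ^ m) (≤-<-trans z≤n (m<s^m s≥2 m)) ⟩
  s ^ m + s ^ m ≡⟨ cong (s ^ m +_) (sym (+-identityʳ (s ^ m))) ⟩
  2 * s ^ m     ≤⟨ *-monoˡ-≤ (s ^ m) s≥2 ⟩
  s * s ^ m     ∎
  where open ≤-Reasoning

powerBracket : ∀ {s c n} .{{_ : NonZero c}} → 2 ≤ s → c * s ≤ n →
  ∃ λ D → c * s ^ suc D ≤ n × n < c * s ^ suc (suc D)
powerBracket {s} {c} {n} s≥2 cs≤n =
  climb n 0 (subst (_≤ n) (cong (c *_) (sym (*-identityʳ s))) cs≤n) n<c·s^[1+n]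
  where
  n<c·s^[1+n] : n < c * s ^ (1 + n)
  n<c·s^[1+n] = <-≤-trans (<-trans (n<1+n n) (m<s^m s≥2 (suc n))) (m≤n*m (s ^ suc n) c)
  -- raise D as long as c·s^(D+2) ≤ n; the fuel f bounds the remaining steps
  climb : ∀ f D → c * s ^ suc D ≤ n → n < c * s ^ (suc D + f) →
          ∃ λ D → c * s ^ suc D ≤ n × n < c * s ^ suc (suc D)
  climb zero D lower upper = ⊥-elim (<⇒≱ (subst (λ k → n < c * s ^ k) (+-identityʳ (suc D)) upper) lower)
  climb (suc f) D lower upper with n <? c * s ^ suc (suc D)
  ... | yes below = D , lower , below
  ... | no notBelow = climb f (suc D) (≮⇒≥ notBelow) (subst (λ k → n < c * s ^ k) (+-suc (suc D) f) upper)

-- The multiplicative core of the final estimate: if n ≤ Q·A, Q³ ≤ n, and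
-- n + M = 2L with 2L ≤ 3M, then nⁿ ≤ A^(2L), because
-- nⁿ·Q^(2L) ≤ nⁿ·(Q³)^M ≤ n^(n+M) = n^(2L) ≤ (Q·A)^(2L).
powerComparison : ∀ {Q A n L M} .{{_ : NonZero Q}} → n ≤ Q * A → Q ^ 3 ≤ n →
  n + M ≡ L + L → L + L ≤ 3 * M → n ^ n ≤ A ^ (L + L)
powerComparison {Q} {A} {n} {L} {M} n≤QA Q³≤n n+M≡2L 2L≤3M =
  *-cancelʳ-≤ (n ^ n) (A ^ (L + L)) (Q ^ (L + L)) {{m^n≢0 Q (L + L)}} (begin
    n ^ n * Q ^ (L + L)       ≤⟨ *-monoʳ-≤ (n ^ n) (^-monoʳ-≤ Q 2L≤3M) ⟩
    n ^ n * Q ^ (3 * M)       ≡⟨ cong (n ^ n *_) (sym (^-*-assoc Q 3 M)) ⟩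
    n ^ n * (Q ^ 3) ^ M       ≤⟨ *-monoʳ-≤ (n ^ n) (^-monoˡ-≤ M Q³≤n) ⟩
    n ^ n * n ^ M             ≡⟨ sym (^-distribˡ-+-* n n M) ⟩
    n ^ (n + M)               ≡⟨ cong (n ^_) n+M≡2L ⟩
    n ^ (L + L)               ≤⟨ ^-monoˡ-≤ (L + L) n≤QA ⟩
    (Q * A) ^ (L + L)         ≡⟨ ^-distribʳ-* Q A (L + L) ⟩
    Q ^ (L + L) * A ^ (L + L) ≡⟨ *-comm (Q ^ (L + L)) (A ^ (L + L)) ⟩
    A ^ (L + L) * Q ^ (L + L) ∎)
  where open ≤-Reasoning

-- Linear bookkeeping for the final estimate: if 4A ≤ n, then n = A + L and
-- n + M = 2L with 2L ≤ 3M, for L = n - A and M = n - 2A ≥ 2A.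
quarterSplit : ∀ {A n} → 4 * A ≤ n →
  ∃ λ L → ∃ λ M → A + L ≡ n × n + M ≡ L + L × L + L ≤ 3 * M
quarterSplit {A} {n} 4A≤n = L , M , A+L≡n , n+M≡2L , 2L≤3M
  where
  open ≤-Reasoning
  L : ℕ
  L = n ∸ A
  A+L≡n : A + L ≡ n
  A+L≡n = m+[n∸m]≡n (≤-trans (m≤n*m A 4) 4A≤n)
  3A≤L : 3 * A ≤ L
  3A≤L = +-cancelˡ-≤ A (3 * A) L (subst (4 * A ≤_) (sym A+L≡n) 4A≤n)
  M : ℕ
  M = L ∸ A
  A+M≡L : A + M ≡ L
  A+M≡L = m+[n∸m]≡n (≤-trans (m≤m+n A (2 * A)) 3A≤L)
  2A≤M : 2 * A ≤ M
  2A≤M = +-cancelˡ-≤ A (2 * A) M (subst (3 * A ≤_) (sym A+M≡L) 3A≤L)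
  n+M≡2L : n + M ≡ L + L
  n+M≡2L = begin-equality
    n + M       ≡⟨ cong (_+ M) (sym A+L≡n) ⟩
    A + L + M   ≡⟨ cong (_+ M) (+-comm A L) ⟩
    L + A + M   ≡⟨ +-assoc L A M ⟩
    L + (A + M) ≡⟨ cong (L +_) A+M≡L ⟩
    L + L       ∎
  2L≤3M : L + L ≤ 3 * M
  2L≤3M = begin
    L + L             ≡⟨ cong₂ _+_ (sym A+M≡L) (sym A+M≡L) ⟩
    (A + M) + (A + M) ≡⟨ +-interchange A M A M ⟩
    (A + A) + (M + M) ≡⟨ cong (λ a → (A + a) + (M + M)) (sym (+-identityʳ A)) ⟩
    2 * A + (M + M)   ≤⟨ +-monoˡ-≤ (M + M) 2A≤M ⟩
    M + (M + M)       ≡⟨ cong (λ m → M + (M + m)) (sym (+-identityʳ M)) ⟩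
    3 * M             ∎

-- Choose D with
-- 4A ≤ n < 4sA for A = s^(D+1) and split n = A + L as in quarterSplit.  The
-- inequality at D gives L(D+1) ≤ 2E, and powerComparison gives
-- nⁿ ≤ A^(2L) = s^((D+1)·2L) ≤ s^(4E).
degreeInequality⇒bound : ∀ {s n E} → 2 ≤ s → (4 * s) ^ 3 ≤ n →
  (∀ D → n * suc D ≤ (E + E) + s ^ suc D * suc D) → n ^ n ≤ s ^ (4 * E)
degreeInequality⇒bound {s} {n} {E} s≥2 Q³≤n degreeInequality = begin
  n ^ n             ≤⟨ powerComparison {L = L} {M = M} n≤QA Q³≤n n+M≡2L 2L≤3M ⟩
  A ^ (L + L)       ≡⟨ ^-*-assoc s j (L + L) ⟩
  s ^ (j * (L + L)) ≤⟨ ^-monoʳ-≤ s exponentBound ⟩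
  s ^ (4 * E)       ∎
  where
  open ≤-Reasoning
  instance
    s≢0 : NonZero s
    s≢0 = >-nonZero (≤-trans (s≤s z≤n) s≥2)
    Q≢0 : NonZero (4 * s)
    Q≢0 = m*n≢0 4 s
  Q : ℕ
  Q = 4 * s
  bracket : ∃ λ D → 4 * s ^ suc D ≤ n × n < 4 * s ^ suc (suc D)
  bracket = powerBracket {c = 4} s≥2 (≤-trans (m≤m*n Q (Q ^ 2) {{m^n≢0 Q 2}}) Q³≤n)
  D j A : ℕ
  D = proj₁ bracket
  j = suc D
  A = s ^ j
  n≤QA : n ≤ Q * A
  n≤QA = <⇒≤ (subst (n <_) (sym (*-assoc 4 s A)) (proj₂ (proj₂ bracket)))
  split : ∃ λ L → ∃ λ M → A + L ≡ n × n + M ≡ L + L × L + L ≤ 3 * M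
  split = quarterSplit (proj₁ (proj₂ bracket))
  L M : ℕ
  L = proj₁ split
  M = proj₁ (proj₂ split)
  A+L≡n : A + L ≡ n
  A+L≡n = proj₁ (proj₂ (proj₂ split))
  n+M≡2L : n + M ≡ L + L
  n+M≡2L = proj₁ (proj₂ (proj₂ (proj₂ split)))
  2L≤3M : L + L ≤ 3 * M
  2L≤3M = proj₂ (proj₂ (proj₂ (proj₂ split)))
  -- the degree inequality at D, with the n = A + L split cancelled
  Lj≤2E : L * j ≤ E + E
  Lj≤2E = +-cancelˡ-≤ (A * j) (L * j) (E + E) (begin
    A * j + L * j     ≡⟨ sym (*-distribʳ-+ j A L) ⟩
    (A + L) * j       ≡⟨ cong (_* j) A+L≡n ⟩
    n * j             ≤⟨ degreeInequality D ⟩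
    (E + E) + A * j   ≡⟨ +-comm (E + E) (A * j) ⟩
    A * j + (E + E)   ∎)
  exponentBound : j * (L + L) ≤ 4 * E
  exponentBound = begin
    j * (L + L)       ≡⟨ *-distribˡ-+ j L L ⟩
    j * L + j * L     ≡⟨ cong₂ _+_ (*-comm j L) (*-comm j L) ⟩
    L * j + L * j     ≤⟨ +-mono-≤ Lj≤2E Lj≤2E ⟩
    (E + E) + (E + E) ≡⟨ four-times E ⟩
    4 * E             ∎
    where
    four-times : ∀ E → (E + E) + (E + E) ≡ 4 * E
    four-times = solve-∀

⌊⌋-sound : ∀ {P : Set} (d : Dec P) → ⌊ d ⌋ ≡ true → P
⌊⌋-sound (yes p) _ = p

∨-true : ∀ {a b} → a ∨ b ≡ true → a ≡ true ⊎ b ≡ true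
∨-true {true} _ = inj₁ refl
∨-true {false} b≡true = inj₂ b≡true

edge⇒distinct : ∀ {n} (G : Graph n) {a b} → adj G a b ≡ true → a ≢ b
edge⇒distinct G {a} ab refl with () ← trans (sym ab) (irrefl G a)

isPair-sound : ∀ {n} {x y a b : Fin n} → isPair x y a b ≡ true → (a ≡ x × b ≡ y) ⊎ (a ≡ y × b ≡ x)
isPair-sound {x = x} {y} {a} {b} same with ∨-true same
... | inj₁ ab≡xy = inj₁ (⌊⌋-sound (a ≟ x) (proj₁ (∧-true ab≡xy)) , ⌊⌋-sound (b ≟ y) (proj₂ (∧-true ab≡xy)))
... | inj₂ ab≡yx = inj₂ (⌊⌋-sound (a ≟ y) (proj₁ (∧-true ab≡yx)) , ⌊⌋-sound (b ≟ x) (proj₂ (∧-true ab≡yx)))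

isPair-miss : ∀ {n} {x y a b : Fin n} → b ≢ x → b ≢ y → isPair x y a b ≡ false
isPair-miss {x = x} {y} {a} {b} b≢x b≢y with b ≟ x | b ≟ y
... | yes b≡x | _ = ⊥-elim (b≢x b≡x)
... | no _ | yes b≡y = ⊥-elim (b≢y b≡y)
... | no _ | no _ = cong₂ _∨_ (∧-zeroʳ ⌊ a ≟ x ⌋) (∧-zeroʳ ⌊ a ≟ y ⌋)

addAdj-away : ∀ {n} (a : Fin n → Fin n → Bool) {x y i j} → isPair x y i j ≡ false → addAdj a x y i j ≡ a i j
addAdj-away a {i = i} {j} away rewrite away = ∨-identityʳ (a i j)

addCol-away : ∀ {n t} (c : Fin n → Fin n → Fin t) {x y α i j} → isPair x y i j ≡ false → addCol c x y α i j ≡ c i j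
addCol-away c away rewrite away = refl

module _ {h n t} {H : Graph h} {a : Fin n → Fin n → Bool} {c : Fin n → Fin n → Fin t} {x y : Fin n} {α : Fin t} where

  restrictCopy : (copy : RainbowCopy H (addAdj a x y) (addCol c x y α)) →
    (∀ u v → adj H u v ≡ true → isPair x y (proj₁ copy u) (proj₁ copy v) ≡ false) →
    RainbowCopy H a c
  restrictCopy (φ , injective , edges , rainbow) away = φ , injective , edges′ , rainbow′
    where
    edges′ : ∀ u v → adj H u v ≡ true → a (φ u) (φ v) ≡ true
    edges′ u v uv = trans (sym (addAdj-away a (away u v uv))) (edges u v uv)
    rainbow′ : ∀ u v u′ v′ → adj H u v ≡ true → adj H u′ v′ ≡ true → c (φ u) (φ v) ≡ c (φ u′) (φ v′) →
               (u ≡ u′ × v ≡ v′) ⊎ (u ≡ v′ × v ≡ u′)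
    rainbow′ u v u′ v′ uv u′v′ same = rainbow u v u′ v′ uv u′v′
      (trans (addCol-away c (away u v uv)) (trans same (sym (addCol-away c (away u′ v′ u′v′)))))

  newPairUsed : ¬ RainbowCopy H a c → (copy : RainbowCopy H (addAdj a x y) (addCol c x y α)) →
    ∃ λ u → ∃ λ v → adj H u v ≡ true × isPair x y (proj₁ copy u) (proj₁ copy v) ≡ true
  newPairUsed noCopy copy@(φ , _)
    with any? (λ u → any? (λ v → (adj H u v ∧ isPair x y (φ u) (φ v)) ≟ᵇ true))
  ... | yes (u , v , used) = u , v , ∧-true used
  ... | no unused = ⊥-elim (noCopy (restrictCopy copy away))
    where
    away : ∀ u v → adj H u v ≡ true → isPair x y (φ u) (φ v) ≡ false
    away u v uv with isPair x y (φ u) (φ v) in onPair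
    ... | false = refl
    ... | true = ⊥-elim (unused (u , v , cong₂ _∧_ uv onPair))

SplitByNeighbour : ∀ {n t} → Graph n → Colouring n t → Fin n → Fin n → Set
SplitByNeighbour G c x y = ∃ λ w → adj G x w ≡ true × adj G y w ≡ true × col c x w ≢ col c y w

-- If a rainbow copy in G + xy sends the edge uv of H onto xy, then a triangle uvw
-- of H gives the common neighbour φ w of x and y, seen in two distinct colours.
triangleSplits : ∀ {h n t} {H : Graph h} (G : Graph n) (c : Colouring n t) {x y α} →
  EveryEdgeInTriangle H →
  (copy : RainbowCopy H (addAdj (adj G) x y) (addCol (col c) x y α)) →
  ∀ {u v} → adj H u v ≡ true → proj₁ copy u ≡ x → proj₁ copy v ≡ y → SplitByNeighbour G c x y
triangleSplits {H = H} G c triangles (φ , injective , edges , rainbow) {u} {v} uv refl refl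
  with triangles u v uv
... | w , uw , vw = φ w , edge-u , edge-v , distinctColours
  where
  φw≢φu : φ w ≢ φ u
  φw≢φu φw≡φu = edge⇒distinct H uw (sym (injective w u φw≡φu))
  φw≢φv : φ w ≢ φ v
  φw≢φv φw≡φv = edge⇒distinct H vw (sym (injective w v φw≡φv))
  away-u : isPair (φ u) (φ v) (φ u) (φ w) ≡ false
  away-u = isPair-miss {a = φ u} φw≢φu φw≢φv
  away-v : isPair (φ u) (φ v) (φ v) (φ w) ≡ false
  away-v = isPair-miss {a = φ v} φw≢φu φw≢φv
  edge-u : adj G (φ u) (φ w) ≡ true
  edge-u = trans (sym (addAdj-away (adj G) away-u)) (edges u w uw)
  edge-v : adj G (φ v) (φ w) ≡ true
  edge-v = trans (sym (addAdj-away (adj G) away-v)) (edges v w vw)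
  distinctColours : col c (φ u) (φ w) ≢ col c (φ v) (φ w)
  distinctColours same
    with rainbow u w v w uw vw (trans (addCol-away (col c) away-u) (trans same (sym (addCol-away (col c) away-v))))
  ... | inj₁ (u≡v , _) = edge⇒distinct H uv u≡v
  ... | inj₂ (u≡w , _) = edge⇒distinct H uw u≡w

saturated⇒split : ∀ {h n t} {H : Graph h} {G : Graph n} {c : Colouring n t} →
  EveryEdgeInTriangle H → Saturated H G c → Fin t →
  ∀ x y → x ≢ y → adj G x y ≡ false → SplitByNeighbour G c x y
saturated⇒split {H = H} {G} {c} triangles saturated α x y x≢y xy∉G
  with Saturated.saturate saturated x y x≢y xy∉G α
... | copy with newPairUsed {H = H} {a = adj G} {c = col c} {x = x} {y = y} {α = α} (Saturated.noRainbow saturated) copy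
... | u , v , uv , onPair with isPair-sound onPair
... | inj₁ (φu≡x , φv≡y) = triangleSplits {H = H} G c {α = α} triangles copy uv φu≡x φv≡y
... | inj₂ (φu≡y , φv≡x) = triangleSplits {H = H} G c {α = α} triangles copy (trans (Graph.sym H v u) uv) φv≡x φu≡y

degree : ∀ {n} → Graph n → Fin n → ℕ
degree {n} G x = ∑[ w < n ] 𝟙 (adj G x w)

degreeSum : ∀ {n} (G : Graph n) → ∑[ x < n ] degree G x ≤ e G + e G
degreeSum {n} G = begin
  ∑[ i < n ] ∑[ j < n ] 𝟙 (adj G i j)                  ≤⟨ ∑-mono-≤ (λ i → ∑-mono-≤ (edgeCounted i)) ⟩
  ∑[ i < n ] ∑[ j < n ] (F i j + F j i)                ≡⟨ sum-cong-≗ (λ i → ∑-distrib-+ (F i) (λ j → F j i)) ⟩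
  ∑[ i < n ] (sum (F i) + ∑[ j < n ] F j i)            ≡⟨ ∑-distrib-+ (λ i → sum (F i)) (λ i → ∑[ j < n ] F j i) ⟩
  ∑[ i < n ] sum (F i) + ∑[ i < n ] ∑[ j < n ] F j i   ≡⟨ cong (∑[ i < n ] sum (F i) +_) (∑-comm (λ i j → F j i)) ⟩
  ∑[ i < n ] sum (F i) + ∑[ j < n ] sum (F j)          ≡⟨ cong₂ _+_ (sym edgeCount-∑) (sym edgeCount-∑) ⟩
  e G + e G                                            ∎
  where
  open ≤-Reasoning
  F : Fin n → Fin n → ℕ
  F i j = if adj G i j ∧ (toℕ i <ᵇ toℕ j) then 1 else 0
  sum-map-tabulate : ∀ {m} (f : Fin n → ℕ) (g : Fin m → Fin n) → List.sum (map f (tabulate g)) ≡ ∑[ i < m ] f (g i)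
  sum-map-tabulate {zero} f g = refl
  sum-map-tabulate {suc m} f g = cong (f (g zero) +_) (sum-map-tabulate f (g ∘ suc))
  edgeCount-∑ : e G ≡ ∑[ i < n ] sum (F i)
  edgeCount-∑ = trans (sum-map-tabulate (λ i → List.sum (map (F i) (tabulate (λ j → j)))) (λ i → i))
                      (sum-cong-≗ (λ i → sum-map-tabulate (F i) (λ j → j)))
  edgeCounted : ∀ i j → 𝟙 (adj G i j) ≤ F i j + F j i
  edgeCounted i j with adj G i j in ij
  ... | false = z≤n
  ... | true with <-cmp (toℕ i) (toℕ j)
  ...   | tri< i<j _ _ rewrite Equivalence.to T-≡ (<⇒<ᵇ i<j) = s≤s z≤n
  ...   | tri≈ _ i≡j _ = ⊥-elim (edge⇒distinct G ij (toℕ-injective i≡j))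
  ...   | tri> _ _ j<i rewrite trans (Graph.sym G j i) ij | Equivalence.to T-≡ (<⇒<ᵇ j<i) = m≤n+m 1 _

-- The vertex boxes, in the grid (Fin (t+1))ⁿ whose letters are 0 and 1 + γ for a
-- colour γ: the box of x has the side {0} at x, the side {1 + c(xw)} at each
-- neighbour w of x, and the full side elsewhere.
module VertexBoxes {n t} (G : Graph n) (c : Colouring n t) where
  open Boxes (suc t)

  singleton : Fin (suc t) → Fin (suc t) → Bool
  singleton p v = ⌊ v ≟ p ⌋

  box : Fin n → Box n
  box x w = if ⌊ w ≟ x ⌋ then singleton zero
            else if adj G x w then singleton (suc (col c x w)) else (λ _ → true)

  box-self : ∀ x v → box x x v ≡ singleton zero v
  box-self x v with x ≟ x
  ... | yes _ = refl
  ... | no x≢x = ⊥-elim (x≢x refl)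

  box-neighbour : ∀ {x w} v → adj G x w ≡ true → box x w v ≡ singleton (suc (col c x w)) v
  box-neighbour {x} {w} v xw with w ≟ x
  ... | yes w≡x = ⊥-elim (edge⇒distinct G xw (sym w≡x))
  ... | no _ rewrite xw = refl

  -- A vertex box has volume ≥ (t+1)ⁿ / (t+1)^(1 + deg x): only x and its
  -- neighbours give sides of size 1 instead of t + 1.
  box-volume : ∀ x → suc t ^ n ≤ vol (box x) * suc t ^ suc (degree G x)
  box-volume x = subst (λ k → suc t ^ n ≤ vol (box x) * suc t ^ k) exponent
    (vol-lowerBound (box x) (λ w → 𝟙 ⌊ w ≟ x ⌋ + 𝟙 (adj G x w)) side-size)
    where
    exponent : ∑[ w < n ] (𝟙 ⌊ w ≟ x ⌋ + 𝟙 (adj G x w)) ≡ suc (degree G x)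
    exponent = trans (∑-distrib-+ (λ w → 𝟙 ⌊ w ≟ x ⌋) (λ w → 𝟙 (adj G x w)))
                     (cong (_+ degree G x) (∑-point x))
    singleton-side : ∀ p → suc t ≤ size (singleton p) * suc t ^ 1
    singleton-side p = ≤-reflexive (sym (begin-equality
      size (singleton p) * suc t ^ 1 ≡⟨ cong (_* suc t ^ 1) (∑-point p) ⟩
      1 * suc t ^ 1                  ≡⟨ *-identityˡ (suc t ^ 1) ⟩
      suc t * 1                      ≡⟨ *-identityʳ (suc t) ⟩
      suc t                          ∎))
      where open ≤-Reasoning
    full-side : suc t ≤ size (λ _ → true) * suc t ^ 0
    full-side = ≤-reflexive (sym (trans (*-identityʳ _) (trans (∑-const (suc t) 1) (*-identityʳ (suc t)))))
    side-size : ∀ w → suc t ≤ size (box x w) * suc t ^ (𝟙 ⌊ w ≟ x ⌋ + 𝟙 (adj G x w))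
    side-size w with w ≟ x
    ... | yes refl rewrite irrefl G w = singleton-side zero
    ... | no _ with adj G x w
    ...   | true = singleton-side (suc (col c x w))
    ...   | false = full-side

  -- Boxes of distinct vertices are separated: at the coordinate x when xy is an
  -- edge ({0} against {1 + c(yx)}), and otherwise at a common neighbour w split
  -- by x and y ({1 + c(xw)} against {1 + c(yw)}).
  boxesSeparated : (∀ x y → x ≢ y → adj G x y ≡ false → SplitByNeighbour G c x y) →
    ∀ x y → x ≢ y → Separated (box x) (box y)
  boxesSeparated split x y x≢y with adj G x y in xy
  ... | true = x , disjointAt-x
    where
    disjointAt-x : ∀ v → box x x v ≡ true → box y x v ≡ true → ⊥
    disjointAt-x v inX inY with ⌊⌋-sound (v ≟ zero) (trans (sym (box-self x v)) inX)
    ... | refl with ⌊⌋-sound (zero ≟ suc (col c y x))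
                      (trans (sym (box-neighbour zero (trans (Graph.sym G y x) xy))) inY)
    ...   | ()
  ... | false with split x y x≢y xy
  ... | w , xw , yw , colours≢ = w , disjointAt-w
    where
    disjointAt-w : ∀ v → box x w v ≡ true → box y w v ≡ true → ⊥
    disjointAt-w v inX inY = colours≢ (suc-injective (trans
      (sym (⌊⌋-sound (v ≟ _) (trans (sym (box-neighbour v xw)) inX)))
      (⌊⌋-sound (v ≟ _) (trans (sym (box-neighbour v yw)) inY))))

suc≤2^ : ∀ t → 1 ≤ t → suc t ≤ 2 ^ t
suc≤2^ (suc zero) _ = ≤-refl
suc≤2^ (suc (suc t)) _ =
  +-mono-≤ (m^n>0 2 (suc t)) (≤-trans (suc≤2^ (suc t) (s≤s z≤n)) (≤-reflexive (sym (+-identityʳ _))))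

-- Each of the t + 1 letters costs at most t bits: (t+1)^(4E) ≤ 2^(4tE).
lettersToBits : ∀ {t} E → 1 ≤ t → suc t ^ (4 * E) ≤ 2 ^ (4 * t * E)
lettersToBits {t} E t≥1 = begin
  suc t ^ (4 * E)   ≤⟨ ^-monoˡ-≤ (4 * E) (suc≤2^ t t≥1) ⟩
  (2 ^ t) ^ (4 * E) ≡⟨ ^-*-assoc 2 t (4 * E) ⟩
  2 ^ (t * (4 * E)) ≡⟨ cong (2 ^_) (reorder t E) ⟩
  2 ^ (4 * t * E)   ∎
  where
  open ≤-Reasoning
  reorder : ∀ t E → t * (4 * E) ≡ 4 * t * E
  reorder = solve-∀

raiseBound : ∀ {n t E} k → n ^ n ≤ 2 ^ (4 * t * E) → n ^ ((k ∸ 1) * n) ≤ 2 ^ (4 * t * k * E)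
raiseBound {n} {t} {E} k nⁿ≤ = begin
  n ^ ((k ∸ 1) * n)           ≡⟨ cong (n ^_) (*-comm (k ∸ 1) n) ⟩
  n ^ (n * (k ∸ 1))           ≡⟨ sym (^-*-assoc n n (k ∸ 1)) ⟩
  (n ^ n) ^ (k ∸ 1)           ≤⟨ ^-monoˡ-≤ (k ∸ 1) nⁿ≤ ⟩
  (2 ^ (4 * t * E)) ^ (k ∸ 1) ≡⟨ ^-*-assoc 2 (4 * t * E) (k ∸ 1) ⟩
  2 ^ (4 * t * E * (k ∸ 1))   ≤⟨ ^-monoʳ-≤ 2 (*-monoʳ-≤ (4 * t * E) (m∸n≤m k 1)) ⟩
  2 ^ (4 * t * E * k)         ≡⟨ cong (2 ^_) (reorder t E k) ⟩
  2 ^ (4 * t * k * E)         ∎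
  where
  open ≤-Reasoning
  reorder : ∀ t E k → 4 * t * E * k ≡ 4 * t * k * E
  reorder = solve-∀

theorem2p2 : ∀ {h} (H : Graph h) → EveryEdgeInTriangle H →
    (t : ℕ) → 1 ≤ t → e H ≤ t →
    (k : ℕ) → 1 ≤ k →
    ∃ λ N → ∀ n → N ≤ n → (G : Graph n) (c : Colouring n t) → Saturated H G c →
      n ^ ((k ∸ 1) * n) ≤ 2 ^ (4 * t * k * e G)
theorem2p2 H triangles t t≥1 _ k _ = (4 * suc t) ^ 3 , bound
  where
  bound : ∀ n → (4 * suc t) ^ 3 ≤ n → (G : Graph n) (c : Colouring n t) → Saturated H G c →
          n ^ ((k ∸ 1) * n) ≤ 2 ^ (4 * t * k * e G)
  bound n large G c saturated = raiseBound {t = t} {E = e G} k (≤-trans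
    (degreeInequality⇒bound {E = e G} (s≤s t≥1) large degreeInequality)
    (lettersToBits (e G) t≥1))
    where
    open Boxes (suc t)
    open VertexBoxes G c
    separated : ∀ x y → x ≢ y → Separated (box x) (box y)
    separated = boxesSeparated (saturated⇒split triangles saturated (fromℕ< t≥1))
    degreeInequality : ∀ D → n * suc D ≤ (e G + e G) + suc t ^ suc D * suc D
    degreeInequality D = ≤-trans (weightBound box (degree G) separated box-volume D)
                                 (+-monoˡ-≤ (suc t ^ suc D * suc D) (degreeSum G))
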